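{- Let $a,b$ be positive integers. For $T \in \mathrm{Inc}^{a+b}(a\times b)$, with cells indexed $(i,j)$, $1\le i\le a$, $1\le j\le b$ ($(1,1)$ upper left, $(a,b)$ lower right), let $J_T = \{(i,j) : T(i,j) = i+j\}$ and define \[ \Theta(T) = \{(a-i+1,\, b-j+1) : (i,j) \in J_T\}. \] Then $\Theta$ is a bijection $\mathrm{Inc}^{a+b}(a\times b) \to J([a]\times[b])$, and $\Theta \circ \mathrm{KPro} = \mathrm{Row} \circ \Theta$.
   Context: An increasing tableau of shape $\lambda$ is a filling of the Young diagram of $\lambda$ with positive integers strictly increasing along rows and down columns; $\mathrm{Inc}^m(\lambda)$ is the set of such tableaux with all entries at most $m$. $a\times b$ is the rectangular partition with $a$ rows of length $b$. K-promotion $\mathrm{KPro}$ on $\mathrm{Inc}^m(\lambda)$: given $T$, delete the entry $1$ (if present), leaving empty cells. The southeast neighbors of a cell are the (at most two) cells immediately to its right and immediately below it. Repeatedly, simultaneously for all empty cells, until no empty cell has a southeast neighbor: label each empty cell by the minimal label among its southeast neighbors and remove that label from each southeast neighbor containing it (those become empty); an empty cell with no southeast neighbors stays unchanged. Finally label all empty cells by $m+1$ and subtract $1$ from every label to get $\mathrm{KPro}(T)$. Here $m=a+b$. $[a]\times[b]$ is the poset $\{(i,j):1\le i\le a, 1\le j\le b\}$ with componentwise order; $J(P)$ is the set of order ideals (down-closed subsets) of a poset $P$. Rowmotion $\mathrm{Row}: J(P)\to J(P)$ sends an order ideal $I$ to the order ideal generated by the minimal elements of $P\setminus I$. -}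

module Defs where

open import Data.Nat using (ℕ; zero; suc; _+_; _∸_; _<_; _≤_; _≡ᵇ_; _≤ᵇ_; _⊓_)
open import Data.Bool using (Bool; true; false; _∧_; _∨_; not; if_then_else_)
open import Data.Fin using (Fin; toℕ; opposite)
import Data.Fin as F
open import Data.Maybe using (Maybe; just; nothing; _>>=_; maybe′)
import Data.Maybe as M
open import Data.Vec using (Vec; lookup; tabulate)
open import Data.Product using (Σ; _×_; _,_)
open import Relation.Binary.PropositionalEquality using (_≡_)

-- A filling of the a × b rectangle: row i (0-based), column j (0-based).
Tab : ℕ → ℕ → Set
Tab a b = Vec (Vec ℕ b) a

-- A subset of the poset [a] × [b] (element (i+1, j+1) ↔ index (i , j)).
Sub : ℕ → ℕ → Set
Sub a b = Vec (Vec Bool b) a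

_at_,_ : {A : Set} {a b : ℕ} → Vec (Vec A b) a → Fin a → Fin b → A
T at i , j = lookup (lookup T i) j

IsInc : {a b : ℕ} → ℕ → Tab a b → Set
IsInc {a} {b} m T =
  (∀ (i : Fin a) (j : Fin b) → 1 ≤ T at i , j × T at i , j ≤ m)
  × (∀ (i : Fin a) (j j' : Fin b) → j F.< j' → T at i , j < T at i , j')
  × (∀ (i i' : Fin a) (j : Fin b) → i F.< i' → T at i , j < T at i' , j)

IsIdeal : {a b : ℕ} → Sub a b → Set
IsIdeal {a} {b} I =
  ∀ (i i' : Fin a) (j j' : Fin b) → I at i , j ≡ true → i' F.≤ i → j' F.≤ j →
    I at i' , j' ≡ true

anyF : {n : ℕ} → (Fin n → Bool) → Bool
anyF {zero} f = false
anyF {suc n} f = f F.zero ∨ anyF (λ i → f (F.suc i))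

allF : {n : ℕ} → (Fin n → Bool) → Bool
allF {zero} f = true
allF {suc n} f = f F.zero ∧ allF (λ i → f (F.suc i))

_≤F_ : {n : ℕ} → Fin n → Fin n → Bool
i ≤F j = toℕ i ≤ᵇ toℕ j

_==F_ : {n : ℕ} → Fin n → Fin n → Bool
i ==F j = toℕ i ≡ᵇ toℕ j

minimalOutside : {a b : ℕ} → Sub a b → Fin a → Fin b → Bool
minimalOutside I k l =
  not (I at k , l) ∧
  allF (λ k' → allF (λ l' →
    not (k' ≤F k ∧ l' ≤F l ∧ not (k' ==F k ∧ l' ==F l)) ∨ (I at k' , l')))

Row : {a b : ℕ} → Sub a b → Sub a b
Row I = tabulate λ i → tabulate λ j →
  anyF (λ k → anyF (λ l → i ≤F k ∧ j ≤F l ∧ minimalOutside I k l))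

-- Θ(T) = {(a-i+1, b-j+1) : T(i,j) = i+j}  (1-based); with 0-based indices
-- (p , q) ∈ Θ(T) iff T(opposite p, opposite q) = (opp p + 1) + (opp q + 1).
Θ : {a b : ℕ} → Tab a b → Sub a b
Θ T = tabulate λ p → tabulate λ q →
  ((T at opposite p , opposite q) ≡ᵇ (suc (toℕ (opposite p)) + suc (toℕ (opposite q))))

-- K-promotion. Intermediate states: nothing = empty cell.
State : ℕ → ℕ → Set
State a b = Fin a → Fin b → Maybe ℕ

nextF : {n : ℕ} → Fin n → Maybe (Fin n)
nextF {suc zero} F.zero = nothing
nextF {suc (suc n)} F.zero = just (F.suc F.zero)
nextF {suc (suc n)} (F.suc i) = M.map F.suc (nextF i)

minM : Maybe ℕ → Maybe ℕ → Maybe ℕ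
minM nothing y = y
minM (just x) nothing = just x
minM (just x) (just y) = just (x ⊓ y)

seMin : {a b : ℕ} → State a b → Fin a → Fin b → Maybe ℕ
seMin S i j = minM (nextF j >>= λ j' → S i j') (nextF i >>= λ i' → S i' j)

isEmpty : Maybe ℕ → Bool
isEmpty nothing = true
isEmpty (just _) = false

eqM : Maybe ℕ → ℕ → Bool
eqM nothing v = false
eqM (just x) v = x ≡ᵇ v

isSE : {a b : ℕ} → Fin a → Fin b → Fin a → Fin b → Bool
isSE i j k l = (i ==F k ∧ (toℕ j ≡ᵇ suc (toℕ l))) ∨ ((toℕ i ≡ᵇ suc (toℕ k)) ∧ j ==F l)

kstep : {a b : ℕ} → State a b → State a b
kstep S i j with S i j
... | nothing = seMin S i j
... | just v =
  if anyF (λ k → anyF (λ l →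
        isEmpty (S k l) ∧ isSE i j k l ∧ eqM (seMin S k l) v))
  then nothing else just v

iter : {A : Set} → ℕ → (A → A) → A → A
iter zero f x = x
iter (suc n) f x = f (iter n f x)

KPro : {a b : ℕ} → Tab a b → Tab a b
KPro {a} {b} T = tabulate λ i → tabulate λ j →
  maybe′ (λ v → v) (suc (a + b)) (final i j) ∸ 1
  where
  init : State a b
  init i j = if ((T at i , j) ≡ᵇ 1) then nothing else just (T at i , j)
  final : State a b
  final = iter (a + b) kstep init

module Submission where

-- An increasing a × b tableau with entries at most a + b strictly increases along rows and
-- columns, which squeezes the entry at (i , j) (0-based) into {i + j + 1, i + j + 2}. The cells
-- with the larger entry ("high" cells) form an up-set that determines the tableau, and Θ is its
-- reflection; this gives the bijection with order ideals.
-- K-promotion slides one antidiagonal per round. The cells it empties are the low cells and the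
-- cells above a maximal low cell; each of them receives the smaller entry of its southeast
-- neighbours (the corner receives a + b + 1), and all other entries stay put. After relabelling,
-- the high cells of KPro T are exactly the cells above a maximal low cell of T. Reflected, the
-- maximal low cells are the minimal elements outside Θ T, so these cells form Row (Θ T).

open import Defs
open import Data.Bool using (Bool; true; false; _∧_; _∨_; not; if_then_else_)
open import Data.Bool.Properties using (T-≡; ¬-not; ∧-zeroʳ)
open import Data.Empty using (⊥; ⊥-elim)
open import Data.Fin using (Fin; toℕ; opposite; fromℕ; fromℕ<)
import Data.Fin as F
import Data.Fin.Properties as FP
open import Data.Maybe using (Maybe; just; nothing; _>>=_; maybe′)
open import Data.Maybe.Properties using (just-injective)
open import Data.Maybe.Relation.Unary.All as All using (All)
open import Data.Nat using (ℕ; zero; suc; _+_; _∸_; _<_; _≤_; _≡ᵇ_; _≤ᵇ_; z≤n; s≤s; z<s)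
open import Data.Nat.Properties
open import Data.Nat.Tactic.RingSolver using (solve-∀)
open import Data.Product using (Σ; ∃; _×_; _,_; proj₁; proj₂)
open import Data.Sum using (_⊎_; inj₁; inj₂; [_,_]′)
import Data.Sum
open import Data.Vec using (Vec; lookup; tabulate)
open import Data.Vec.Properties using (lookup∘tabulate; tabulate∘lookup; tabulate-cong)
open import Function using (_∘_; Equivalence)
open import Relation.Binary.Definitions using (Tri; tri<; tri≈; tri>)
open import Relation.Binary.PropositionalEquality
open import Relation.Nullary using (Dec; yes; no)

∧-true⁻ : ∀ {x y} → x ∧ y ≡ true → x ≡ true × y ≡ true
∧-true⁻ {true} {true} _ = refl , refl

∧-true⁺ : ∀ {x y} → x ≡ true → y ≡ true → x ∧ y ≡ true
∧-true⁺ refl refl = refl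

∧-false⁻ : ∀ {x y} → x ∧ y ≡ false → x ≡ false ⊎ y ≡ false
∧-false⁻ {false} _ = inj₁ refl
∧-false⁻ {true}  e = inj₂ e

∨-true⁻ : ∀ {x y} → x ∨ y ≡ true → x ≡ true ⊎ y ≡ true
∨-true⁻ {true}  _ = inj₁ refl
∨-true⁻ {false} e = inj₂ e

∨-trueˡ : ∀ {x y} → x ≡ true → x ∨ y ≡ true
∨-trueˡ refl = refl

∨-trueʳ : ∀ {x y} → y ≡ true → x ∨ y ≡ true
∨-trueʳ {true}  _ = refl
∨-trueʳ {false} e = e

not-true⁻ : ∀ {x} → not x ≡ true → x ≡ false
not-true⁻ {false} _ = refl

not-true⁺ : ∀ {x} → x ≡ false → not x ≡ true
not-true⁺ refl = refl

true≢false : ∀ {x} → x ≡ true → x ≢ false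
true≢false refl ()

implication⁻ : ∀ {c x} → not c ∨ x ≡ true → c ≡ true → x ≡ true
implication⁻ e refl = e

implication⁺ : ∀ {c x} → (c ≡ true → x ≡ true) → not c ∨ x ≡ true
implication⁺ {true}  h = h refl
implication⁺ {false} h = refl

by-cases : ∀ {P : Set} x → (x ≡ true → P) → (x ≡ false → P) → P
by-cases true  t _ = t refl
by-cases false _ f = f refl

bool-ext : ∀ {x y} → (x ≡ true → y ≡ true) → (y ≡ true → x ≡ true) → x ≡ y
bool-ext {true}  {true}  _ _ = refl
bool-ext {true}  {false} f _ = sym (f refl)
bool-ext {false} {true}  _ g = g refl
bool-ext {false} {false} _ _ = refl

≡ᵇ-true⁻ : ∀ {m n} → (m ≡ᵇ n) ≡ true → m ≡ n
≡ᵇ-true⁻ {m} {n} e = ≡ᵇ⇒≡ m n (Equivalence.from T-≡ e)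

≡ᵇ-true⁺ : ∀ {m n} → m ≡ n → (m ≡ᵇ n) ≡ true
≡ᵇ-true⁺ {m} {n} e = Equivalence.to T-≡ (≡⇒≡ᵇ m n e)

≡ᵇ-false⁺ : ∀ {m n} → m ≢ n → (m ≡ᵇ n) ≡ false
≡ᵇ-false⁺ m≢n = ¬-not (m≢n ∘ ≡ᵇ-true⁻)

≤ᵇ-true⁻ : ∀ {m n} → (m ≤ᵇ n) ≡ true → m ≤ n
≤ᵇ-true⁻ {m} {n} e = ≤ᵇ⇒≤ m n (Equivalence.from T-≡ e)

≤ᵇ-true⁺ : ∀ {m n} → m ≤ n → (m ≤ᵇ n) ≡ true
≤ᵇ-true⁺ m≤n = Equivalence.to T-≡ (≤⇒≤ᵇ m≤n)

just≢nothing : ∀ {A : Set} {x : A} → just x ≢ nothing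
just≢nothing ()

maybe′-true⁺ : ∀ {A : Set} {f : A → Bool} (m : Maybe A) → (∀ {x} → m ≡ just x → f x ≡ true) →
  maybe′ f true m ≡ true
maybe′-true⁺ nothing  _ = refl
maybe′-true⁺ (just x) h = h refl

maybe′-false⁻ : ∀ {A : Set} {f : A → Bool} (m : Maybe A) → maybe′ f true m ≡ false →
  ∃ λ x → m ≡ just x × f x ≡ false
maybe′-false⁻ (just x) e = x , refl , e

>>=-All : ∀ {A : Set} {P : ℕ → Set} (m : Maybe A) (f : A → Maybe ℕ) →
  (∀ {x} → m ≡ just x → All P (f x)) → All P (m >>= f)
>>=-All nothing  f h = All.nothing
>>=-All (just x) f h = h refl

>>=-just-nothing⁻ : ∀ {A : Set} (m : Maybe A) {g : A → ℕ} → (m >>= λ x → just (g x)) ≡ nothing → m ≡ nothing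
>>=-just-nothing⁻ nothing _ = refl

>>=-cong : ∀ {A : Set} (m : Maybe A) {f g : A → Maybe ℕ} → (∀ {x} → m ≡ just x → f x ≡ g x) →
  (m >>= f) ≡ (m >>= g)
>>=-cong nothing  h = refl
>>=-cong (just x) h = h refl

minM-nothing⁻ : ∀ {x y} → minM x y ≡ nothing → x ≡ nothing × y ≡ nothing
minM-nothing⁻ {nothing} {nothing} _ = refl , refl
minM-nothing⁻ {nothing} {just _}  ()
minM-nothing⁻ {just _}  {nothing} ()
minM-nothing⁻ {just _}  {just _}  ()

minM-attains : ∀ {d x y} → All (d ≤_) x → All (d ≤_) y → x ≡ just d ⊎ y ≡ just d → minM x y ≡ just d
minM-attains (All.just _)   (All.just d≤y) (inj₁ refl) = cong just (m≤n⇒m⊓n≡m d≤y)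
minM-attains (All.just d≤x) (All.just _)   (inj₂ refl) = cong just (m≥n⇒m⊓n≡n d≤x)
minM-attains (All.just _)   All.nothing    (inj₁ refl) = refl
minM-attains All.nothing    (All.just _)   (inj₂ refl) = refl

minM-constant : ∀ {e x y} → All (_≡ e) x → All (_≡ e) y → (x ≡ nothing → y ≡ nothing → ⊥) →
  minM x y ≡ just e
minM-constant (All.just refl) (All.just refl) _  = cong just (⊓-idem _)
minM-constant (All.just refl) All.nothing     _  = refl
minM-constant All.nothing     (All.just refl) _  = refl
minM-constant All.nothing     All.nothing     ne = ⊥-elim (ne refl refl)

isEmpty-true⁻ : ∀ {m} → isEmpty m ≡ true → m ≡ nothing
isEmpty-true⁻ {nothing} _ = refl

eqM-true⁻ : ∀ {m v} → eqM m v ≡ true → m ≡ just v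
eqM-true⁻ {just x} e = cong just (≡ᵇ-true⁻ e)

eqM-refl : ∀ v → eqM (just v) v ≡ true
eqM-refl v = ≡ᵇ-true⁺ {v} refl

anyF-witness : ∀ {n} (f : Fin n → Bool) → anyF f ≡ true → ∃ λ i → f i ≡ true
anyF-witness {suc n} f e with ∨-true⁻ {f F.zero} e
... | inj₁ f0 = F.zero , f0
... | inj₂ fs with anyF-witness (f ∘ F.suc) fs
...   | i , fi = F.suc i , fi

anyF-intro : ∀ {n} (f : Fin n → Bool) i → f i ≡ true → anyF f ≡ true
anyF-intro f F.zero    e = ∨-trueˡ e
anyF-intro f (F.suc i) e = ∨-trueʳ {f F.zero} (anyF-intro (f ∘ F.suc) i e)

allF-elim : ∀ {n} (f : Fin n → Bool) → allF f ≡ true → ∀ i → f i ≡ true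
allF-elim f e F.zero    = proj₁ (∧-true⁻ e)
allF-elim f e (F.suc i) = allF-elim (f ∘ F.suc) (proj₂ (∧-true⁻ {f F.zero} e)) i

allF-intro : ∀ {n} (f : Fin n → Bool) → (∀ i → f i ≡ true) → allF f ≡ true
allF-intro {zero}  f h = refl
allF-intro {suc n} f h = ∧-true⁺ (h F.zero) (allF-intro (f ∘ F.suc) (h ∘ F.suc))

fin-with-toℕ : ∀ {m n} → m < n → ∃ λ (i : Fin n) → toℕ i ≡ m
fin-with-toℕ m<n = fromℕ< m<n , FP.toℕ-fromℕ< m<n

origin : ∀ {n} → Fin n → Fin n
origin {suc n} _ = F.zero

toℕ-origin : ∀ {n} (i : Fin n) → toℕ (origin i) ≡ 0
toℕ-origin {suc n} _ = refl

corner : ∀ {n} → Fin n → Fin n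
corner {suc n} _ = fromℕ n

toℕ-corner : ∀ {n} (i : Fin n) → suc (toℕ (corner i)) ≡ n
toℕ-corner {suc n} _ = cong suc (FP.toℕ-fromℕ n)

opposite-antitone : ∀ {n} {i j : Fin n} → toℕ i ≤ toℕ j → toℕ (opposite j) ≤ toℕ (opposite i)
opposite-antitone {n} {i} {j} i≤j =
  subst₂ _≤_ (sym (FP.opposite-prop j)) (sym (FP.opposite-prop i)) (∸-monoʳ-≤ n (s≤s i≤j))

opposite-antitone-< : ∀ {n} {i j : Fin n} → toℕ i < toℕ j → toℕ (opposite j) < toℕ (opposite i)
opposite-antitone-< {i = i} {j} i<j =
  subst₂ _<_ (sym (FP.opposite-prop j)) (sym (FP.opposite-prop i)) (∸-monoʳ-< (s≤s i<j) (FP.toℕ<n j))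

opposite-galois : ∀ {n} {i j : Fin n} → toℕ (opposite i) ≤ toℕ j → toℕ (opposite j) ≤ toℕ i
opposite-galois {i = i} p = subst (λ k → _ ≤ toℕ k) (FP.opposite-involutive i) (opposite-antitone p)

opposite-galois′ : ∀ {n} {i j : Fin n} → toℕ i ≤ toℕ (opposite j) → toℕ j ≤ toℕ (opposite i)
opposite-galois′ {j = j} p = subst (λ k → toℕ k ≤ _) (FP.opposite-involutive j) (opposite-antitone p)

opposite-galois-< : ∀ {n} {i j : Fin n} → toℕ (opposite i) < toℕ j → toℕ (opposite j) < toℕ i
opposite-galois-< {i = i} p = subst (λ k → _ < toℕ k) (FP.opposite-involutive i) (opposite-antitone-< p)

distinct⁺ : ∀ {a b} {k k' : Fin a} {l l' : Fin b} → toℕ k' < toℕ k ⊎ toℕ l' < toℕ l → not (k' ==F k ∧ l' ==F l) ≡ true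
distinct⁺ (inj₁ k'<k) rewrite ≡ᵇ-false⁺ (<⇒≢ k'<k) = refl
distinct⁺ {k = k} {k'} (inj₂ l'<l) rewrite ≡ᵇ-false⁺ (<⇒≢ l'<l) | ∧-zeroʳ (k' ==F k) = refl

distinct⁻ : ∀ {a b} {k k' : Fin a} {l l' : Fin b} → not (k' ==F k ∧ l' ==F l) ≡ true → toℕ k' ≢ toℕ k ⊎ toℕ l' ≢ toℕ l
distinct⁻ {k = k} {k'} e with ∧-false⁻ {k' ==F k} (not-true⁻ e)
... | inj₁ ne = inj₁ λ eq → true≢false (≡ᵇ-true⁺ eq) ne
... | inj₂ ne = inj₂ λ eq → true≢false (≡ᵇ-true⁺ eq) ne

nextF-just⁻ : ∀ {n} {i i' : Fin n} → nextF i ≡ just i' → toℕ i' ≡ suc (toℕ i)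
nextF-just⁻ {suc (suc n)} {F.zero} refl = refl
nextF-just⁻ {suc (suc n)} {F.suc i} e with nextF i in eq
nextF-just⁻ {suc (suc n)} {F.suc i} refl | just k = cong suc (nextF-just⁻ eq)

nextF-nothing⁻ : ∀ {n} {i : Fin n} → nextF i ≡ nothing → suc (toℕ i) ≡ n
nextF-nothing⁻ {suc zero}    {F.zero}  _ = refl
nextF-nothing⁻ {suc (suc n)} {F.suc i} e with nextF i in eq
nextF-nothing⁻ {suc (suc n)} {F.suc i} e | nothing = cong suc (nextF-nothing⁻ eq)

nextF-just⁺ : ∀ {n} {i i' : Fin n} → toℕ i' ≡ suc (toℕ i) → nextF i ≡ just i'
nextF-just⁺ {suc (suc n)} {F.zero}  {F.suc F.zero} _ = refl
nextF-just⁺ {suc (suc n)} {F.suc i} {F.suc k} e rewrite nextF-just⁺ {i = i} {k} (suc-injective e) = refl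

successor : ∀ {n} {i j : Fin n} → toℕ i < toℕ j → ∃ λ i' → nextF i ≡ just i'
successor {j = j} i<j with fin-with-toℕ (≤-<-trans i<j (FP.toℕ<n j))
... | i' , toℕ-i' = i' , nextF-just⁺ toℕ-i'

predecessor : ∀ {n} {i : Fin n} {x} → x < toℕ i → ∃ λ k → nextF k ≡ just i
predecessor {i = i} x<i with toℕ i in e
... | zero  = ⊥-elim (n≮0 x<i)
... | suc y with fin-with-toℕ (≤-trans (n≤1+n _) (subst (_< _) e (FP.toℕ<n i)))
...   | k , toℕ-k = k , nextF-just⁺ (trans e (cong suc (sym toℕ-k)))

at-tabulate : ∀ {A : Set} {a b} (f : Fin a → Fin b → A) i j →
  (tabulate λ i → tabulate λ j → f i j) at i , j ≡ f i j
at-tabulate f i j rewrite lookup∘tabulate (λ i → tabulate λ j → f i j) i = lookup∘tabulate (f i) j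

≡-entrywise : ∀ {A : Set} {a b} {X Y : Vec (Vec A b) a} → (∀ i j → X at i , j ≡ Y at i , j) → X ≡ Y
≡-entrywise {X = X} {Y} h = ≡-lookup X Y λ i → ≡-lookup _ _ (h i)
  where
  ≡-lookup : ∀ {A : Set} {n} (xs ys : Vec A n) → (∀ i → lookup xs i ≡ lookup ys i) → xs ≡ ys
  ≡-lookup xs ys h = trans (sym (tabulate∘lookup xs)) (trans (tabulate-cong h) (tabulate∘lookup ys))

strictMono-gap : ∀ {n} (f : Fin n → ℕ) → (∀ i j → i F.< j → f i < f j) →
  ∀ {i j} → toℕ i ≤ toℕ j → f i + toℕ j ≤ f j + toℕ i
strictMono-gap f mono {F.zero}  {F.zero}  _ = ≤-refl
strictMono-gap f mono {F.zero}  {F.suc F.zero} _ =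
  subst₂ _≤_ (+-comm 1 _) (sym (+-identityʳ _)) (mono F.zero (F.suc F.zero) (s≤s z≤n))
strictMono-gap f mono {F.zero}  {F.suc (F.suc j)} _ = begin
  f F.zero + suc (suc (toℕ j))   ≡⟨ +-suc (f F.zero) (suc (toℕ j)) ⟩
  suc (f F.zero) + suc (toℕ j)   ≤⟨ +-monoˡ-≤ (suc (toℕ j)) (mono F.zero (F.suc F.zero) (s≤s z≤n)) ⟩
  f (F.suc F.zero) + suc (toℕ j) ≤⟨ strictMono-gap (f ∘ F.suc) (λ i j p → mono (F.suc i) (F.suc j) (s≤s p)) {F.zero} {F.suc j} z≤n ⟩
  f (F.suc (F.suc j)) + 0        ∎
  where open ≤-Reasoning
strictMono-gap f mono {F.suc i} {F.suc j} (s≤s i≤j) =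
  subst₂ _≤_ (sym (+-suc _ _)) (sym (+-suc _ _))
    (s≤s (strictMono-gap (f ∘ F.suc) (λ i j p → mono (F.suc i) (F.suc j) (s≤s p)) i≤j))

diag : ∀ {a b} → Fin a → Fin b → ℕ
diag i j = toℕ i + toℕ j

suc+suc : ∀ m n → suc m + suc n ≡ suc (suc (m + n))
suc+suc m n = cong suc (+-suc m n)

-- high? T i j says that (i + 1 , j + 1) ∈ J_T in the paper's 1-based notation.
high? : ∀ {a b} → Tab a b → Fin a → Fin b → Bool
high? T i j = T at i , j ≡ᵇ suc (toℕ i) + suc (toℕ j)

Θ-at : ∀ {a b} (T : Tab a b) p q → Θ T at p , q ≡ high? T (opposite p) (opposite q)
Θ-at T = at-tabulate λ p q → high? T (opposite p) (opposite q)

Θ-at-opposite : ∀ {a b} (T : Tab a b) i j → Θ T at opposite i , opposite j ≡ high? T i j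
Θ-at-opposite T i j
  rewrite Θ-at T (opposite i) (opposite j) | FP.opposite-involutive i | FP.opposite-involutive j = refl

Row-at : ∀ {a b} (I : Sub a b) p q → Row I at p , q ≡ anyF λ k → anyF λ l → p ≤F k ∧ q ≤F l ∧ minimalOutside I k l
Row-at I = at-tabulate λ p q → anyF λ k → anyF λ l → p ≤F k ∧ q ≤F l ∧ minimalOutside I k l

module Increasing {a b : ℕ} (T : Tab a b) (inc : IsInc (a + b) T) where

  V : Fin a → Fin b → ℕ
  V i j = T at i , j

  private
    bounds = proj₁ inc
    rowInc = proj₁ (proj₂ inc)
    colInc = proj₂ (proj₂ inc)

  entry-gap : ∀ {i i' j j'} → toℕ i ≤ toℕ i' → toℕ j ≤ toℕ j' → V i j + diag i' j' ≤ V i' j' + diag i j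
  entry-gap {i} {i'} {j} {j'} i≤i' j≤j' = begin
    V i j + (toℕ i' + toℕ j')   ≡⟨ x+[y+z]≡[x+z]+y (V i j) (toℕ i') (toℕ j') ⟩
    (V i j + toℕ j') + toℕ i'   ≤⟨ +-monoˡ-≤ (toℕ i') (strictMono-gap (V i) (rowInc i) j≤j') ⟩
    (V i j' + toℕ j) + toℕ i'   ≡⟨ [x+y]+z≡[x+z]+y (V i j') (toℕ j) (toℕ i') ⟩
    (V i j' + toℕ i') + toℕ j   ≤⟨ +-monoˡ-≤ (toℕ j) (strictMono-gap (λ k → V k j') (λ k k' → colInc k k' j') i≤i') ⟩
    (V i' j' + toℕ i) + toℕ j   ≡⟨ +-assoc (V i' j') (toℕ i) (toℕ j) ⟩
    V i' j' + (toℕ i + toℕ j)   ∎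
    where
    open ≤-Reasoning
    x+[y+z]≡[x+z]+y : ∀ x y z → x + (y + z) ≡ (x + z) + y
    x+[y+z]≡[x+z]+y = solve-∀
    [x+y]+z≡[x+z]+y : ∀ x y z → (x + y) + z ≡ (x + z) + y
    [x+y]+z≡[x+z]+y = solve-∀

  entry-lower : ∀ i j → suc (diag i j) ≤ V i j
  entry-lower i j = begin
    suc (diag i j)               ≤⟨ +-monoˡ-≤ (diag i j) (proj₁ (bounds i₀ j₀)) ⟩
    V i₀ j₀ + diag i j           ≤⟨ entry-gap (≤-trans (≤-reflexive toℕ-i₀) z≤n) (≤-trans (≤-reflexive toℕ-j₀) z≤n) ⟩
    V i j + diag i₀ j₀           ≡⟨ cong₂ (λ x y → V i j + (x + y)) toℕ-i₀ toℕ-j₀ ⟩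
    V i j + 0                    ≡⟨ +-identityʳ (V i j) ⟩
    V i j                        ∎
    where
    open ≤-Reasoning
    i₀ = origin i
    j₀ = origin j
    toℕ-i₀ : toℕ i₀ ≡ 0
    toℕ-i₀ = toℕ-origin i
    toℕ-j₀ : toℕ j₀ ≡ 0
    toℕ-j₀ = toℕ-origin j

  entry-upper : ∀ i j → V i j ≤ suc (suc (diag i j))
  entry-upper i j = +-cancelʳ-≤ (diag i₁ j₁) _ _ (begin
    V i j + diag i₁ j₁                          ≤⟨ entry-gap (toℕ≤corner i) (toℕ≤corner j) ⟩
    V i₁ j₁ + diag i j                          ≤⟨ +-monoˡ-≤ (diag i j) (proj₂ (bounds i₁ j₁)) ⟩
    (a + b) + diag i j                          ≡⟨ cong₂ (λ x y → (x + y) + diag i j) (toℕ-corner i) (toℕ-corner j) ⟨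
    (suc (toℕ i₁) + suc (toℕ j₁)) + diag i j    ≡⟨ rearrange (toℕ i₁) (toℕ j₁) (diag i j) ⟩
    suc (suc (diag i j)) + diag i₁ j₁           ∎)
    where
    open ≤-Reasoning
    i₁ = corner i
    j₁ = corner j
    toℕ≤corner : ∀ {n} (k : Fin n) → toℕ k ≤ toℕ (corner k)
    toℕ≤corner k = ≤-pred (subst (toℕ k <_) (sym (toℕ-corner k)) (FP.toℕ<n k))
    rearrange : ∀ x y d → (suc x + suc y) + d ≡ suc (suc d) + (x + y)
    rearrange = solve-∀

  high-value : ∀ {i j} → high? T i j ≡ true → V i j ≡ suc (suc (diag i j))
  high-value {i} {j} e = trans (≡ᵇ-true⁻ e) (suc+suc (toℕ i) (toℕ j))

  high-value⁻ : ∀ {i j} → V i j ≡ suc (suc (diag i j)) → high? T i j ≡ true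
  high-value⁻ {i} {j} e = ≡ᵇ-true⁺ (trans e (sym (suc+suc (toℕ i) (toℕ j))))

  low-value : ∀ {i j} → high? T i j ≡ false → V i j ≡ suc (diag i j)
  low-value {i} {j} e = ≤-antisym
    (≤-pred (≤∧≢⇒< (entry-upper i j) (λ h → true≢false (high-value⁻ h) e)))
    (entry-lower i j)

  low-value⁻ : ∀ {i j} → V i j ≡ suc (diag i j) → high? T i j ≡ false
  low-value⁻ e = ¬-not λ h → 1+n≢n (trans (sym (high-value h)) e)

  low-downward : ∀ {i i' j j'} → high? T i j ≡ false → toℕ i' ≤ toℕ i → toℕ j' ≤ toℕ j →
    high? T i' j' ≡ false
  low-downward {i} {i'} {j} {j'} low i'≤i j'≤j = low-value⁻ (≤-antisym
    (+-cancelʳ-≤ (diag i j) _ _ (begin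
      V i' j' + diag i j            ≤⟨ entry-gap i'≤i j'≤j ⟩
      V i j + diag i' j'            ≡⟨ cong (_+ diag i' j') (low-value low) ⟩
      suc (diag i j) + diag i' j'   ≡⟨ cong suc (+-comm (diag i j) (diag i' j')) ⟩
      suc (diag i' j') + diag i j   ∎))
    (entry-lower i' j'))
    where open ≤-Reasoning

  high-upward : ∀ {i i' j j'} → high? T i j ≡ true → toℕ i ≤ toℕ i' → toℕ j ≤ toℕ j' →
    high? T i' j' ≡ true
  high-upward high i≤i' j≤j' = ¬-not λ low → true≢false high (low-downward low i≤i' j≤j')

Θ-isIdeal : ∀ {a b} (T : Tab a b) → IsInc (a + b) T → IsIdeal (Θ T)
Θ-isIdeal T inc i i' j j' e i'≤i j'≤j =
  trans (Θ-at T i' j')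
    (high-upward (trans (sym (Θ-at T i j)) e) (opposite-antitone i'≤i) (opposite-antitone j'≤j))
  where open Increasing T inc

Θ-injective : ∀ {a b} (T T' : Tab a b) → IsInc (a + b) T → IsInc (a + b) T' → Θ T ≡ Θ T' → T ≡ T'
Θ-injective T T' inc inc' ΘT≡ΘT' = ≡-entrywise entry
  where
  module I = Increasing T inc
  module I' = Increasing T' inc'
  same-high : ∀ i j → high? T i j ≡ high? T' i j
  same-high i j = begin
    high? T i j                         ≡⟨ Θ-at-opposite T i j ⟨
    Θ T at opposite i , opposite j      ≡⟨ cong (λ X → X at opposite i , opposite j) ΘT≡ΘT' ⟩
    Θ T' at opposite i , opposite j     ≡⟨ Θ-at-opposite T' i j ⟩
    high? T' i j                        ∎
    where open ≡-Reasoning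
  entry : ∀ i j → T at i , j ≡ T' at i , j
  entry i j with high? T i j in h
  ... | true  = trans (I.high-value h) (sym (I'.high-value (trans (sym (same-high i j)) h)))
  ... | false = trans (I.low-value h) (sym (I'.low-value (trans (sym (same-high i j)) h)))

bit : Bool → ℕ
bit true  = 1
bit false = 0

+bit-mono-< : ∀ {d d' x x'} → d < d' → (x ≡ true → x' ≡ true) → suc d + bit x < suc d' + bit x'
+bit-mono-< {d} {d'} {false} {x'} d<d' _ = s≤s (begin-strict
  d + 0          ≡⟨ +-identityʳ d ⟩
  d              <⟨ d<d' ⟩
  d'             ≤⟨ m≤m+n d' (bit x') ⟩
  d' + bit x'    ∎)
  where open ≤-Reasoning
+bit-mono-< {x = true} d<d' x⇒x' rewrite x⇒x' refl = +-monoˡ-< 1 (s≤s d<d')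

+bit-detects : ∀ d x → (suc d + bit x ≡ᵇ suc (suc d)) ≡ x
+bit-detects d true  = ≡ᵇ-true⁺ (+-comm (suc d) 1)
+bit-detects d false = ≡ᵇ-false⁺ λ e → 1+n≢n (sym (trans (sym (+-identityʳ (suc d))) e))

fromIdeal : ∀ {a b} → Sub a b → Tab a b
fromIdeal I = tabulate λ i → tabulate λ j → suc (diag i j) + bit (I at opposite i , opposite j)

fromIdeal-isInc : ∀ {a b} (I : Sub a b) → IsIdeal I → IsInc (a + b) (fromIdeal I)
fromIdeal-isInc {a} {b} I ideal = bounded , rows , columns
  where
  entry : ∀ i j → fromIdeal I at i , j ≡ suc (diag i j) + bit (I at opposite i , opposite j)
  entry = at-tabulate λ i j → suc (diag i j) + bit (I at opposite i , opposite j)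
  bit≤1 : ∀ x → bit x ≤ 1
  bit≤1 true  = ≤-refl
  bit≤1 false = z≤n
  bounded : ∀ i j → 1 ≤ fromIdeal I at i , j × fromIdeal I at i , j ≤ a + b
  bounded i j rewrite entry i j = s≤s z≤n , (begin
    suc (diag i j) + bit (I at opposite i , opposite j) ≤⟨ +-monoʳ-≤ (suc (diag i j)) (bit≤1 _) ⟩
    suc (diag i j) + 1                                  ≡⟨ +-comm (suc (diag i j)) 1 ⟩
    suc (suc (diag i j))                                ≡⟨ suc+suc (toℕ i) (toℕ j) ⟨
    suc (toℕ i) + suc (toℕ j)                           ≤⟨ +-mono-≤ (FP.toℕ<n i) (FP.toℕ<n j) ⟩
    a + b                                               ∎)
    where open ≤-Reasoning
  rows : ∀ i j j' → j F.< j' → fromIdeal I at i , j < fromIdeal I at i , j'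
  rows i j j' j<j' rewrite entry i j | entry i j' =
    +bit-mono-< (+-monoʳ-< (toℕ i) j<j') λ e → ideal _ _ _ _ e ≤-refl (opposite-antitone (<⇒≤ j<j'))
  columns : ∀ i i' j → i F.< i' → fromIdeal I at i , j < fromIdeal I at i' , j
  columns i i' j i<i' rewrite entry i j | entry i' j =
    +bit-mono-< (+-monoˡ-< (toℕ j) i<i') λ e → ideal _ _ _ _ e (opposite-antitone (<⇒≤ i<i')) ≤-refl

high?-fromIdeal : ∀ {a b} (I : Sub a b) i j → high? (fromIdeal I) i j ≡ I at opposite i , opposite j
high?-fromIdeal I i j = begin
  (fromIdeal I at i , j ≡ᵇ suc (toℕ i) + suc (toℕ j))
    ≡⟨ cong₂ _≡ᵇ_ (at-tabulate (λ i j → suc (diag i j) + bit (I at opposite i , opposite j)) i j)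
                  (suc+suc (toℕ i) (toℕ j)) ⟩
  (suc (diag i j) + bit (I at opposite i , opposite j) ≡ᵇ suc (suc (diag i j)))
    ≡⟨ +bit-detects (diag i j) (I at opposite i , opposite j) ⟩
  I at opposite i , opposite j ∎
  where open ≡-Reasoning

Θ-fromIdeal : ∀ {a b} (I : Sub a b) → Θ (fromIdeal I) ≡ I
Θ-fromIdeal I = ≡-entrywise λ p q →
  trans (Θ-at (fromIdeal I) p q)
    (trans (high?-fromIdeal I (opposite p) (opposite q))
      (cong₂ (I at_,_) (FP.opposite-involutive p) (FP.opposite-involutive q)))

data SENeighbour {a b} : Fin a → Fin b → Fin a → Fin b → Set where
  right : ∀ {k l l'} → nextF l ≡ just l' → SENeighbour k l k l'
  down  : ∀ {k k' l} → nextF k ≡ just k' → SENeighbour k l k' l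

module _ {a b} {k i : Fin a} {l j : Fin b} where

  SENeighbour-diag : SENeighbour k l i j → diag i j ≡ suc (diag k l)
  SENeighbour-diag (right e) = trans (cong (toℕ k +_) (nextF-just⁻ e)) (+-suc _ _)
  SENeighbour-diag (down e)  = cong (_+ toℕ l) (nextF-just⁻ e)

  SENeighbour-row : SENeighbour k l i j → toℕ k ≤ toℕ i
  SENeighbour-row (right _) = ≤-refl
  SENeighbour-row (down e)  = ≤-trans (n≤1+n _) (≤-reflexive (sym (nextF-just⁻ e)))

  SENeighbour-col : SENeighbour k l i j → toℕ l ≤ toℕ j
  SENeighbour-col (right e) = ≤-trans (n≤1+n _) (≤-reflexive (sym (nextF-just⁻ e)))
  SENeighbour-col (down _)  = ≤-refl

  SENeighbour-strict : SENeighbour k l i j → toℕ k < toℕ i ⊎ toℕ l < toℕ j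
  SENeighbour-strict (right e) = inj₂ (≤-reflexive (sym (nextF-just⁻ e)))
  SENeighbour-strict (down e)  = inj₁ (≤-reflexive (sym (nextF-just⁻ e)))

  SENeighbour-not-corner : SENeighbour k l i j → nextF l ≡ nothing → nextF k ≡ nothing → ⊥
  SENeighbour-not-corner (right e) e' _ = just≢nothing (trans (sym e) e')
  SENeighbour-not-corner (down e)  _ e' = just≢nothing (trans (sym e) e')

  isSE⁺ : SENeighbour k l i j → isSE i j k l ≡ true
  isSE⁺ (right e) = ∨-trueˡ (∧-true⁺ (≡ᵇ-true⁺ {toℕ k} refl) (≡ᵇ-true⁺ (nextF-just⁻ e)))
  isSE⁺ (down e)  = ∨-trueʳ (∧-true⁺ (≡ᵇ-true⁺ (nextF-just⁻ e)) (≡ᵇ-true⁺ {toℕ l} refl))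

  isSE⁻ : isSE i j k l ≡ true → SENeighbour k l i j
  isSE⁻ e with ∨-true⁻ {(toℕ i ≡ᵇ toℕ k) ∧ (toℕ j ≡ᵇ suc (toℕ l))} e
  ... | inj₁ r with ∧-true⁻ r
  ...   | i≡k , j≡l+1 rewrite FP.toℕ-injective (≡ᵇ-true⁻ {toℕ i} i≡k) = right (nextF-just⁺ (≡ᵇ-true⁻ j≡l+1))
  isSE⁻ e | inj₂ d with ∧-true⁻ {toℕ i ≡ᵇ suc (toℕ k)} d
  ...   | i≡k+1 , j≡l rewrite FP.toℕ-injective (≡ᵇ-true⁻ {toℕ j} j≡l) = down (nextF-just⁺ (≡ᵇ-true⁻ i≡k+1))

module _ {a b} (S : State a b) {k : Fin a} {l : Fin b} where

  neighbours-All : ∀ {P : ℕ → Set} → (∀ {i j} → SENeighbour k l i j → All P (S i j)) →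
    All P (nextF l >>= S k) × All P (nextF k >>= λ k' → S k' l)
  neighbours-All h = >>=-All (nextF l) (S k) (h ∘ right) , >>=-All (nextF k) (λ k' → S k' l) (h ∘ down)

  neighbour-bind : ∀ {i j} → SENeighbour k l i j →
    (nextF l >>= S k) ≡ S i j ⊎ (nextF k >>= λ k' → S k' l) ≡ S i j
  neighbour-bind (right e) = inj₁ (cong (_>>= S k) e)
  neighbour-bind (down e)  = inj₂ (cong (_>>= λ k' → S k' l) e)

  seMin-corner : nextF l ≡ nothing → nextF k ≡ nothing → seMin S k l ≡ nothing
  seMin-corner e₁ e₂ rewrite e₁ | e₂ = refl

  corner-or-neighbour : (nextF l ≡ nothing × nextF k ≡ nothing) ⊎ Σ (Fin a) λ i → Σ (Fin b) λ j → SENeighbour k l i j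
  corner-or-neighbour with nextF l in e₁ | nextF k in e₂
  ... | just l' | _       = inj₂ (k , l' , right e₁)
  ... | nothing | just k' = inj₂ (k' , l , down e₂)
  ... | nothing | nothing = inj₁ (refl , refl)

seMin-local : ∀ {a b} (S S' : State a b) {k l} → (∀ {i j} → SENeighbour k l i j → S i j ≡ S' i j) →
  seMin S k l ≡ seMin S' k l
seMin-local S S' {k} {l} h = cong₂ minM (>>=-cong (nextF l) (h ∘ right)) (>>=-cong (nextF k) (h ∘ down))

wavefront : ℕ → ℕ → Maybe ℕ → ℕ → Maybe ℕ
wavefront r d s v with <-cmp d r
... | tri< _ _ _ = s
... | tri≈ _ _ _ = nothing
... | tri> _ _ _ = just v

wavefront-< : ∀ {r d} s v → d < r → wavefront r d s v ≡ s
wavefront-< {r} {d} s v d<r with <-cmp d r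
... | tri< _ _ _   = refl
... | tri≈ d≮r _ _ = ⊥-elim (d≮r d<r)
... | tri> d≮r _ _ = ⊥-elim (d≮r d<r)

wavefront-≡ : ∀ {r d} s v → d ≡ r → wavefront r d s v ≡ nothing
wavefront-≡ {r} {d} s v d≡r with <-cmp d r
... | tri< _ d≢r _ = ⊥-elim (d≢r d≡r)
... | tri≈ _ _ _   = refl
... | tri> _ d≢r _ = ⊥-elim (d≢r d≡r)

wavefront-> : ∀ {r d} s v → r < d → wavefront r d s v ≡ just v
wavefront-> {r} {d} s v r<d with <-cmp d r
... | tri< _ _ r≮d = ⊥-elim (r≮d r<d)
... | tri≈ _ _ r≮d = ⊥-elim (r≮d r<d)
... | tri> _ _ _   = refl

wavefront-nothing⁻ : ∀ {r d} s v → wavefront r d s v ≡ nothing → (d < r × s ≡ nothing) ⊎ d ≡ r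
wavefront-nothing⁻ {r} {d} s v e with <-cmp d r
... | tri< d<r _ _ = inj₁ (d<r , e)
... | tri≈ _ d≡r _ = inj₂ d≡r

module Sliding {a b : ℕ} (T : Tab a b) (inc : IsInc (a + b) T) where
  open Increasing T inc

  original : State a b
  original i j = just (V i j)

  seAllHigh : Fin a → Fin b → Bool
  seAllHigh k l = maybe′ (high? T k) true (nextF l) ∧ maybe′ (λ k' → high? T k' l) true (nextF k)

  seAllHigh⁻ : ∀ {k l i j} → seAllHigh k l ≡ true → SENeighbour k l i j → high? T i j ≡ true
  seAllHigh⁻ {k} {l} e (right e') =
    subst (λ m → maybe′ (high? T k) true m ≡ true) e' (proj₁ (∧-true⁻ e))
  seAllHigh⁻ {k} {l} e (down e') =
    subst (λ m → maybe′ (λ k' → high? T k' l) true m ≡ true) e' (proj₂ (∧-true⁻ {maybe′ (high? T k) true (nextF l)} e))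

  seAllHigh⁺ : ∀ {k l} → (∀ {i j} → SENeighbour k l i j → high? T i j ≡ true) → seAllHigh k l ≡ true
  seAllHigh⁺ {k} {l} h = ∧-true⁺ (maybe′-true⁺ (nextF l) (h ∘ right)) (maybe′-true⁺ (nextF k) (h ∘ down))

  LowNeighbour : Fin a → Fin b → Set
  LowNeighbour k l = Σ (Fin a) λ i → Σ (Fin b) λ j → SENeighbour k l i j × high? T i j ≡ false

  seAllHigh-false⁻ : ∀ {k l} → seAllHigh k l ≡ false → LowNeighbour k l
  seAllHigh-false⁻ {k} {l} e with ∧-false⁻ {maybe′ (high? T k) true (nextF l)} e
  ... | inj₁ r = let l' , e' , low = maybe′-false⁻ (nextF l) r in k , l' , right e' , low
  ... | inj₂ d = let k' , e' , low = maybe′-false⁻ (nextF k) d in k' , l , down e' , low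

  MaxLow : Fin a → Fin b → Set
  MaxLow m n = high? T m n ≡ false × seAllHigh m n ≡ true

  AboveMaxLow : Fin a → Fin b → Set
  AboveMaxLow i j = Σ (Fin a) λ m → Σ (Fin b) λ n → toℕ m ≤ toℕ i × toℕ n ≤ toℕ j × MaxLow m n

  maxLow-dominates : ∀ {m n x y} → MaxLow m n → toℕ m ≤ toℕ x → toℕ n ≤ toℕ y →
    toℕ m < toℕ x ⊎ toℕ n < toℕ y → high? T x y ≡ true
  maxLow-dominates (_ , seHigh) _ n≤y (inj₁ m<x) with successor m<x
  ... | _ , e = high-upward (seAllHigh⁻ seHigh (down e)) (≤-trans (≤-reflexive (nextF-just⁻ e)) m<x) n≤y
  maxLow-dominates (_ , seHigh) m≤x _ (inj₂ n<y) with successor n<y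
  ... | _ , e = high-upward (seAllHigh⁻ seHigh (right e)) m≤x (≤-trans (≤-reflexive (nextF-just⁻ e)) n<y)

  aboveMaxLow-upward : ∀ {k l i j} → AboveMaxLow k l → toℕ k ≤ toℕ i → toℕ l ≤ toℕ j → AboveMaxLow i j
  aboveMaxLow-upward (m , n , m≤k , n≤l , maxLow) k≤i l≤j = m , n , ≤-trans m≤k k≤i , ≤-trans n≤l l≤j , maxLow

  aboveMaxLow-seAllHigh : ∀ {k l} → AboveMaxLow k l → seAllHigh k l ≡ true
  aboveMaxLow-seAllHigh (m , n , m≤k , n≤l , maxLow) = seAllHigh⁺ λ nb →
    maxLow-dominates maxLow (≤-trans m≤k (SENeighbour-row nb)) (≤-trans n≤l (SENeighbour-col nb))
      (Data.Sum.map (≤-<-trans m≤k) (≤-<-trans n≤l) (SENeighbour-strict nb))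

  -- The cells emptied at some round of K-promotion.
  sliding? : Fin a → Fin b → Bool
  sliding? i j = not (high? T i j) ∨
    anyF λ m → anyF λ n → (m ≤F i) ∧ (n ≤F j) ∧ not (high? T m n) ∧ seAllHigh m n

  sliding?-true⁻ : ∀ {i j} → sliding? i j ≡ true → high? T i j ≡ false ⊎ AboveMaxLow i j
  sliding?-true⁻ {i} {j} e with ∨-true⁻ {not (high? T i j)} e
  ... | inj₁ low = inj₁ (not-true⁻ low)
  ... | inj₂ above with anyF-witness _ above
  ...   | m , above-m with anyF-witness _ above-m
  ...     | n , cond with ∧-true⁻ {m ≤F i} cond
  ...       | m≤i , cond' with ∧-true⁻ {n ≤F j} cond'
  ...         | n≤j , cond'' with ∧-true⁻ {not (high? T m n)} cond''
  ...           | low , seHigh = inj₂ (m , n , ≤ᵇ-true⁻ m≤i , ≤ᵇ-true⁻ n≤j , not-true⁻ low , seHigh)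

  sliding?-low : ∀ {i j} → high? T i j ≡ false → sliding? i j ≡ true
  sliding?-low low = ∨-trueˡ (not-true⁺ low)

  sliding?-above : ∀ {i j} → AboveMaxLow i j → sliding? i j ≡ true
  sliding?-above {i} {j} (m , n , m≤i , n≤j , low , seHigh) = ∨-trueʳ {not (high? T i j)}
    (anyF-intro _ m (anyF-intro _ n
      (∧-true⁺ (≤ᵇ-true⁺ m≤i) (∧-true⁺ (≤ᵇ-true⁺ n≤j) (∧-true⁺ (not-true⁺ low) seHigh)))))

  sliding?-false⁻ : ∀ {i j} → sliding? i j ≡ false → high? T i j ≡ true
  sliding?-false⁻ e = ¬-not λ low → true≢false (sliding?-low low) e

  sliding-seAllHigh⇒aboveMaxLow : ∀ {i j} → sliding? i j ≡ true → seAllHigh i j ≡ true → AboveMaxLow i j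
  sliding-seAllHigh⇒aboveMaxLow {i} {j} e seHigh with sliding?-true⁻ e
  ... | inj₁ low   = i , j , ≤-refl , ≤-refl , low , seHigh
  ... | inj₂ above = above

  neighbour-lower : ∀ {k l i j} → SENeighbour k l i j → suc (suc (diag k l)) ≤ V i j
  neighbour-lower {i = i} {j} nb = subst (_≤ V i j) (cong suc (SENeighbour-diag nb)) (entry-lower i j)

  seMin-low-neighbour : ∀ {k l i j} → SENeighbour k l i j → high? T i j ≡ false →
    seMin original k l ≡ just (V i j)
  seMin-low-neighbour {k} {l} {i} {j} nb low =
    minM-attains (proj₁ bounds) (proj₂ bounds) (neighbour-bind original nb)
    where
    V≡ : V i j ≡ suc (suc (diag k l))
    V≡ = trans (low-value low) (cong suc (SENeighbour-diag nb))
    bounds = neighbours-All original λ nb' → All.just (subst (_≤ _) (sym V≡) (neighbour-lower nb'))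

  seMin-seAllHigh : ∀ {k l i j} → SENeighbour k l i j → seAllHigh k l ≡ true →
    seMin original k l ≡ just (V i j)
  seMin-seAllHigh {k} {l} {i} {j} nb seHigh =
    minM-constant (proj₁ values) (proj₂ values) λ r d →
      SENeighbour-not-corner nb (>>=-just-nothing⁻ (nextF l) r) (>>=-just-nothing⁻ (nextF k) d)
    where
    high-neighbour : ∀ {i' j'} → SENeighbour k l i' j' → V i' j' ≡ suc (suc (suc (diag k l)))
    high-neighbour nb' = trans (high-value (seAllHigh⁻ seHigh nb')) (cong (suc ∘ suc) (SENeighbour-diag nb'))
    values = neighbours-All original λ nb' → All.just (trans (high-neighbour nb') (sym (high-neighbour nb)))

  seMin-high-neighbour⁻ : ∀ {k l i j} → SENeighbour k l i j → high? T i j ≡ true →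
    seMin original k l ≡ just (V i j) → seAllHigh k l ≡ true
  seMin-high-neighbour⁻ {k} {l} {i} {j} nb high e = ¬-not λ notAll →
    let i' , j' , nb' , low = seAllHigh-false⁻ notAll in
    1+n≢n (begin
      suc (suc (suc (diag k l)))  ≡⟨ cong (suc ∘ suc) (SENeighbour-diag nb) ⟨
      suc (suc (diag i j))        ≡⟨ high-value high ⟨
      V i j                       ≡⟨ just-injective (trans (sym e) (seMin-low-neighbour nb' low)) ⟩
      V i' j'                     ≡⟨ low-value low ⟩
      suc (diag i' j')            ≡⟨ cong suc (SENeighbour-diag nb') ⟩
      suc (suc (diag k l))        ∎)
    where open ≡-Reasoning

  -- The state after r sliding rounds: a sliding cell on an antidiagonal before r already holds
  -- the minimum of its southeast neighbours' original entries, one on antidiagonal r is empty,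
  -- and every other cell keeps its entry.
  afterRounds : ℕ → State a b
  afterRounds r i j =
    if sliding? i j then wavefront r (diag i j) (seMin original i j) (V i j) else just (V i j)

  afterRounds-fixed : ∀ {r i j} → sliding? i j ≡ false → afterRounds r i j ≡ just (V i j)
  afterRounds-fixed e rewrite e = refl

  afterRounds-sliding : ∀ {r i j} → sliding? i j ≡ true →
    afterRounds r i j ≡ wavefront r (diag i j) (seMin original i j) (V i j)
  afterRounds-sliding e rewrite e = refl

  afterRounds-ahead : ∀ {r i j} → r < diag i j → afterRounds r i j ≡ just (V i j)
  afterRounds-ahead {r} {i} {j} r<d with sliding? i j
  ... | true  = wavefront-> _ _ r<d
  ... | false = refl

  afterRounds-nothing⁻ : ∀ {r i j} → afterRounds r i j ≡ nothing →
    sliding? i j ≡ true × ((diag i j < r × seMin original i j ≡ nothing) ⊎ diag i j ≡ r)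
  afterRounds-nothing⁻ {r} {i} {j} e with sliding? i j in s
  ... | true = refl , wavefront-nothing⁻ _ _ e

  afterRounds-before : ∀ {r i j} → diag i j < r → sliding? i j ≡ true → afterRounds r i j ≡ seMin original i j
  afterRounds-before d<r s = trans (afterRounds-sliding s) (wavefront-< _ _ d<r)

  afterRounds-front : ∀ {r i j} → diag i j ≡ r → sliding? i j ≡ true → afterRounds r i j ≡ nothing
  afterRounds-front d≡r s = trans (afterRounds-sliding s) (wavefront-≡ _ _ d≡r)

  parent-of : ∀ {i j} → 0 < diag i j → Σ (Fin a) λ k → Σ (Fin b) λ l → SENeighbour k l i j
  parent-of {i} {j} pos with 0 <? toℕ i
  ... | yes 0<i = let k , e = predecessor 0<i in k , j , down e
  ... | no  0≮i = let l , e = predecessor (subst (λ d → 0 < d + toℕ j) (n≤0⇒n≡0 (≮⇒≥ 0≮i)) pos) in i , l , right e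

  parent-aboveMaxLow : ∀ {i j} → AboveMaxLow i j → high? T i j ≡ true →
    Σ (Fin a) λ k → Σ (Fin b) λ l → SENeighbour k l i j × AboveMaxLow k l
  parent-aboveMaxLow {i} {j} (m , n , m≤i , n≤j , low , seHigh) high with m≤n⇒m<n∨m≡n m≤i
  ... | inj₁ m<i = let k , e = predecessor m<i in
    k , j , down e , m , n , ≤-pred (≤-trans m<i (≤-reflexive (nextF-just⁻ e))) , n≤j , low , seHigh
  ... | inj₂ m≡i with m≤n⇒m<n∨m≡n n≤j
  ...   | inj₁ n<j = let l , e = predecessor n<j in
    i , l , right e , m , n , m≤i , ≤-pred (≤-trans n<j (≤-reflexive (nextF-just⁻ e))) , low , seHigh
  ...   | inj₂ n≡j = ⊥-elim (true≢false high
    (subst₂ (λ x y → high? T x y ≡ false) (FP.toℕ-injective m≡i) (FP.toℕ-injective n≡j) low))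

  -- Exactly the condition under which kstep empties a cell holding v.
  pulled : State a b → Fin a → Fin b → ℕ → Bool
  pulled S i j v = anyF λ k → anyF λ l → isEmpty (S k l) ∧ isSE i j k l ∧ eqM (seMin S k l) v

  module Round (r : ℕ) (S : State a b) (S≗ : ∀ i j → S i j ≡ afterRounds r i j) where

    seMin-on-front : ∀ {k l} → diag k l ≡ r → seMin S k l ≡ seMin original k l
    seMin-on-front d≡r = seMin-local S original λ nb →
      trans (S≗ _ _) (afterRounds-ahead (≤-reflexive (sym (trans (SENeighbour-diag nb) (cong suc d≡r)))))

    record Puller (i : Fin a) (j : Fin b) (v : ℕ) : Set where
      field
        k         : Fin a
        l         : Fin b
        neighbour : SENeighbour k l i j
        on-front  : diag k l ≡ r
        sliding   : sliding? k l ≡ true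
        value     : seMin original k l ≡ just v

    pulled⁻ : ∀ {i j v} → pulled S i j v ≡ true → Puller i j v
    pulled⁻ {i} {j} {v} e with anyF-witness _ e
    ... | k , e' with anyF-witness _ e'
    ... | l , c with ∧-true⁻ {isEmpty (S k l)} c
    ... | empty , c' with ∧-true⁻ {isSE i j k l} c'
    ... | se , val with afterRounds-nothing⁻ (trans (sym (S≗ k l)) (isEmpty-true⁻ empty))
    ... | slides , inj₂ d≡r = record
      { k = k ; l = l ; neighbour = isSE⁻ {i = i} {j = j} se ; on-front = d≡r ; sliding = slides
      ; value = trans (sym (seMin-on-front d≡r)) (eqM-true⁻ val) }
    ... | _ , inj₁ (_ , none) = let r , d = minM-nothing⁻ none in
      ⊥-elim (SENeighbour-not-corner (isSE⁻ {i = i} {j = j} se) (>>=-just-nothing⁻ (nextF l) r) (>>=-just-nothing⁻ (nextF k) d))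

    pulled⁺ : ∀ {i j k l v} → SENeighbour k l i j → diag k l ≡ r → sliding? k l ≡ true →
      seMin original k l ≡ just v → pulled S i j v ≡ true
    pulled⁺ {k = k} {l} {v} nb d≡r slides val = anyF-intro _ k (anyF-intro _ l
      (∧-true⁺ (cong isEmpty (trans (S≗ k l) (afterRounds-front d≡r slides)))
        (∧-true⁺ (isSE⁺ nb) (trans (cong (λ m → eqM m v) (trans (seMin-on-front d≡r) val)) (eqM-refl v)))))

    pulled⇒on-next-front : ∀ {i j v} → pulled S i j v ≡ true → diag i j ≡ suc r
    pulled⇒on-next-front {i} {j} e = let open Puller (pulled⁻ {i} {j} e) in trans (SENeighbour-diag neighbour) (cong suc on-front)

    pulled⇒sliding : ∀ {i j} → pulled S i j (V i j) ≡ true → sliding? i j ≡ true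
    pulled⇒sliding {i} {j} e = by-cases (high? T i j) high-case sliding?-low
      where
      open Puller (pulled⁻ {i} {j} e)
      high-case : high? T i j ≡ true → sliding? i j ≡ true
      high-case h = sliding?-above (aboveMaxLow-upward
        (sliding-seAllHigh⇒aboveMaxLow sliding (seMin-high-neighbour⁻ neighbour h value))
        (SENeighbour-row neighbour) (SENeighbour-col neighbour))

    parent-on-front : ∀ {i k : Fin a} {j l : Fin b} → diag i j ≡ suc r → SENeighbour k l i j → diag k l ≡ r
    parent-on-front d≡r+1 nb = suc-injective (trans (sym (SENeighbour-diag nb)) d≡r+1)

    low⇒pulled : ∀ {i j} → diag i j ≡ suc r → high? T i j ≡ false → pulled S i j (V i j) ≡ true
    low⇒pulled {i} {j} d≡r+1 low = let k , l , nb = parent-of {i} {j} (subst (0 <_) (sym d≡r+1) z<s) in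
      pulled⁺ nb (parent-on-front d≡r+1 nb)
        (sliding?-low (low-downward low (SENeighbour-row nb) (SENeighbour-col nb)))
        (seMin-low-neighbour nb low)

    aboveMaxLow⇒pulled : ∀ {i j} → diag i j ≡ suc r → AboveMaxLow i j → high? T i j ≡ true →
      pulled S i j (V i j) ≡ true
    aboveMaxLow⇒pulled d≡r+1 above high = let k , l , nb , above' = parent-aboveMaxLow above high in
      pulled⁺ nb (parent-on-front d≡r+1 nb) (sliding?-above above')
        (seMin-seAllHigh nb (aboveMaxLow-seAllHigh above'))

    sliding⇒pulled : ∀ {i j} → diag i j ≡ suc r → sliding? i j ≡ true → pulled S i j (V i j) ≡ true
    sliding⇒pulled {i} {j} d≡r+1 slides = by-cases (high? T i j)
      (λ high → [ (λ low → ⊥-elim (true≢false high low)) , (λ above → aboveMaxLow⇒pulled d≡r+1 above high) ]′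
                  (sliding?-true⁻ slides))
      (low⇒pulled d≡r+1)

    refill : ∀ {i j} → S i j ≡ nothing → seMin S i j ≡ afterRounds (suc r) i j
    refill {i} {j} e with afterRounds-nothing⁻ (trans (sym (S≗ i j)) e)
    ... | slides , inj₁ (d<r , none) = let r' , d' = minM-nothing⁻ none in begin
      seMin S i j                 ≡⟨ seMin-corner S (>>=-just-nothing⁻ (nextF j) r') (>>=-just-nothing⁻ (nextF i) d') ⟩
      nothing                     ≡⟨ none ⟨
      seMin original i j          ≡⟨ afterRounds-before (m<n⇒m<1+n d<r) slides ⟨
      afterRounds (suc r) i j     ∎
      where open ≡-Reasoning
    ... | slides , inj₂ d≡r = trans (seMin-on-front d≡r)
      (sym (afterRounds-before (≤-reflexive (cong suc d≡r)) slides))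

    keep : ∀ {i j v} → S i j ≡ just v → pulled S i j v ≡ false → just v ≡ afterRounds (suc r) i j
    keep {i} {j} {v} e unpulled = trans (sym e) (trans (S≗ i j) (by-cases (sliding? i j) unchanged
      λ fixed → trans (afterRounds-fixed fixed) (sym (afterRounds-fixed fixed))))
      where
      unchanged : sliding? i j ≡ true → afterRounds r i j ≡ afterRounds (suc r) i j
      unchanged slides = by-position (<-cmp (diag i j) r)
        where
        by-position : Tri (diag i j < r) (diag i j ≡ r) (r < diag i j) → afterRounds r i j ≡ afterRounds (suc r) i j
        by-position (tri< d<r _ _) =
          trans (afterRounds-before d<r slides) (sym (afterRounds-before (m<n⇒m<1+n d<r) slides))
        by-position (tri≈ _ d≡r _) =
          ⊥-elim (just≢nothing (trans (sym e) (trans (S≗ i j) (afterRounds-front d≡r slides))))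
        by-position (tri> _ _ r<d) with m≤n⇒m<n∨m≡n r<d
        ... | inj₁ r+1<d = trans (afterRounds-ahead r<d) (sym (afterRounds-ahead r+1<d))
        ... | inj₂ r+1≡d = ⊥-elim (true≢false
              (subst (λ w → pulled S i j w ≡ true) V≡v (sliding⇒pulled (sym r+1≡d) slides)) unpulled)
          where
          V≡v : V i j ≡ v
          V≡v = just-injective (trans (sym (afterRounds-ahead r<d)) (trans (sym (S≗ i j)) e))

    vacate : ∀ {i j v} → S i j ≡ just v → pulled S i j v ≡ true → afterRounds (suc r) i j ≡ nothing
    vacate {i} {j} {v} e p = afterRounds-front d≡r+1 (pulled⇒sliding (subst (λ w → pulled S i j w ≡ true) v≡V p))
      where
      d≡r+1 = pulled⇒on-next-front {i} {j} p
      v≡V : v ≡ V i j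
      v≡V = just-injective (trans (sym e) (trans (S≗ i j) (afterRounds-ahead (≤-reflexive (sym d≡r+1)))))

    round : ∀ i j → kstep S i j ≡ afterRounds (suc r) i j
    round i j with S i j in e
    ... | nothing = refill e
    ... | just v  = by-cases (pulled S i j v)
      (λ p → subst (λ x → (if x then nothing else just v) ≡ _) (sym p) (sym (vacate e p)))
      (λ p → subst (λ x → (if x then nothing else just v) ≡ _) (sym p) (keep e p))

  -- Definitionally the initial state in the local definition of KPro.
  initial : State a b
  initial i j = if (T at i , j ≡ᵇ 1) then nothing else just (T at i , j)

  initial-afterRounds : ∀ i j → initial i j ≡ afterRounds 0 i j
  initial-afterRounds i j = by-cases (V i j ≡ᵇ 1)
    (λ one → let d≡0 , low = entry-one⁻ (≡ᵇ-true⁻ one) in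
      trans (cong (if_then nothing else just (V i j)) one) (sym (afterRounds-front d≡0 (sliding?-low low))))
    (λ notOne → trans (cong (if_then nothing else just (V i j)) notOne) (sym (afterRounds-unmoved notOne)))
    where
    entry-one⁻ : V i j ≡ 1 → diag i j ≡ 0 × high? T i j ≡ false
    entry-one⁻ V≡1 = d≡0 , low-value⁻ (trans V≡1 (cong suc (sym d≡0)))
      where d≡0 = n≤0⇒n≡0 (≤-pred (subst (suc (diag i j) ≤_) V≡1 (entry-lower i j)))
    origin-sliding⁻ : diag i j ≡ 0 → sliding? i j ≡ true → V i j ≡ 1
    origin-sliding⁻ d≡0 slides = trans (low-value low) (cong suc d≡0)
      where
      low : high? T i j ≡ false
      low with sliding?-true⁻ slides
      ... | inj₁ low = low
      ... | inj₂ (m , n , _ , _ , low-mn , _) = low-downward low-mn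
            (subst (_≤ toℕ m) (sym (m+n≡0⇒m≡0 (toℕ i) d≡0)) z≤n)
            (subst (_≤ toℕ n) (sym (m+n≡0⇒n≡0 (toℕ i) d≡0)) z≤n)
    afterRounds-unmoved : (V i j ≡ᵇ 1) ≡ false → afterRounds 0 i j ≡ just (V i j)
    afterRounds-unmoved notOne = unmoved (diag i j ≟ 0)
      where
      unmoved : Dec (diag i j ≡ 0) → afterRounds 0 i j ≡ just (V i j)
      unmoved (yes d≡0) = afterRounds-fixed (¬-not λ slides → true≢false (≡ᵇ-true⁺ (origin-sliding⁻ d≡0 slides)) notOne)
      unmoved (no  d≢0) = afterRounds-ahead (n≢0⇒n>0 d≢0)

  iterate-afterRounds : ∀ r i j → iter r kstep initial i j ≡ afterRounds r i j
  iterate-afterRounds zero    = initial-afterRounds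
  iterate-afterRounds (suc r) = Round.round r (iter r kstep initial) (iterate-afterRounds r)

  readout : Maybe ℕ → ℕ
  readout m = maybe′ (λ v → v) (suc (a + b)) m ∸ 1

  KPro-at : ∀ i j → KPro T at i , j ≡ readout (afterRounds (a + b) i j)
  KPro-at i j = trans (at-tabulate _ i j) (cong readout (iterate-afterRounds (a + b) i j))

  high?-KPro : ∀ i j → high? (KPro T) i j ≡ sliding? i j ∧ seAllHigh i j
  high?-KPro i j = trans (cong (_≡ᵇ suc (toℕ i) + suc (toℕ j)) (KPro-at i j))
    (by-cases (sliding? i j) moved unmoved)
    where
    target = suc (toℕ i) + suc (toℕ j)
    read-high : ∀ {w} → w ≡ suc (suc (diag i j)) → (w ≡ᵇ target) ≡ true
    read-high e = ≡ᵇ-true⁺ (trans e (sym (suc+suc (toℕ i) (toℕ j))))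
    read-low : ∀ {w} → w ≡ suc (diag i j) → (w ≡ᵇ target) ≡ false
    read-low e = ≡ᵇ-false⁺ λ e' → 1+n≢n (trans (trans (sym (suc+suc (toℕ i) (toℕ j))) (sym e')) e)
    diag<a+b : diag i j < a + b
    diag<a+b = +-mono-<-≤ (FP.toℕ<n i) (<⇒≤ (FP.toℕ<n j))
    unmoved : sliding? i j ≡ false → (readout (afterRounds (a + b) i j) ≡ᵇ target) ≡ sliding? i j ∧ seAllHigh i j
    unmoved fixed rewrite afterRounds-fixed {a + b} fixed | fixed =
      read-low (cong (_∸ 1) (high-value (sliding?-false⁻ fixed)))
    moved : sliding? i j ≡ true → (readout (afterRounds (a + b) i j) ≡ᵇ target) ≡ sliding? i j ∧ seAllHigh i j
    moved slides rewrite afterRounds-before diag<a+b slides | slides with corner-or-neighbour original {i} {j}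
    ... | inj₁ (last-col , last-row) rewrite seMin-corner original last-col last-row =
      trans (read-high a+b≡) (sym (seAllHigh⁺ λ nb → ⊥-elim (SENeighbour-not-corner nb last-col last-row)))
      where
      a+b≡ : a + b ≡ suc (suc (diag i j))
      a+b≡ = trans (cong₂ _+_ (sym (nextF-nothing⁻ last-row)) (sym (nextF-nothing⁻ last-col))) (suc+suc (toℕ i) (toℕ j))
    ... | inj₂ (i' , j' , nb) = by-cases (seAllHigh i j)
      (λ seHigh → trans (cong (λ m → readout m ≡ᵇ target) (seMin-seAllHigh nb seHigh))
        (trans (read-high (cong (_∸ 1) (trans (high-value (seAllHigh⁻ seHigh nb)) (cong (suc ∘ suc) (SENeighbour-diag nb)))))
          (sym seHigh)))
      (λ notAll → let i'' , j'' , nb' , low = seAllHigh-false⁻ notAll in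
        trans (cong (λ m → readout m ≡ᵇ target) (seMin-low-neighbour nb' low))
          (trans (read-low (cong (_∸ 1) (trans (low-value low) (cong suc (SENeighbour-diag nb'))))) (sym notAll)))

  minimalOutside-Θ⁻ : ∀ {k l} → minimalOutside (Θ T) k l ≡ true → MaxLow (opposite k) (opposite l)
  minimalOutside-Θ⁻ {k} {l} e = trans (sym (Θ-at T k l)) (not-true⁻ outside) , seAllHigh⁺ neighbour-high
    where
    outside = proj₁ (∧-true⁻ e)
    below = proj₂ (∧-true⁻ {not (Θ T at k , l)} e)
    neighbour-high : ∀ {i j} → SENeighbour (opposite k) (opposite l) i j → high? T i j ≡ true
    neighbour-high {i} {j} nb = trans (sym (Θ-at-opposite T i j))
      (implication⁻ (allF-elim _ (allF-elim _ below (opposite i)) (opposite j))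
        (∧-true⁺ (≤ᵇ-true⁺ (opposite-galois (SENeighbour-row nb)))
          (∧-true⁺ (≤ᵇ-true⁺ (opposite-galois (SENeighbour-col nb)))
            (distinct⁺ (Data.Sum.map opposite-galois-< opposite-galois-< (SENeighbour-strict nb))))))

  minimalOutside-Θ⁺ : ∀ {k l} → MaxLow (opposite k) (opposite l) → minimalOutside (Θ T) k l ≡ true
  minimalOutside-Θ⁺ {k} {l} maxLow@(low , _) =
    ∧-true⁺ (not-true⁺ (trans (Θ-at T k l) low)) (allF-intro _ λ k' → allF-intro _ λ l' → implication⁺ (below k' l'))
    where
    below : ∀ k' l' → (k' ≤F k ∧ l' ≤F l ∧ not (k' ==F k ∧ l' ==F l)) ≡ true → Θ T at k' , l' ≡ true
    below k' l' c with ∧-true⁻ c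
    ... | k'≤k , c' with ∧-true⁻ {l' ≤F l} c'
    ...   | l'≤l , d = trans (Θ-at T k' l') (maxLow-dominates maxLow
      (opposite-antitone (≤ᵇ-true⁻ k'≤k)) (opposite-antitone (≤ᵇ-true⁻ l'≤l))
      (Data.Sum.map (opposite-antitone-< ∘ ≤∧≢⇒< (≤ᵇ-true⁻ k'≤k)) (opposite-antitone-< ∘ ≤∧≢⇒< (≤ᵇ-true⁻ l'≤l)) (distinct⁻ d)))

  Row-Θ⁻ : ∀ {p q} → Row (Θ T) at p , q ≡ true → AboveMaxLow (opposite p) (opposite q)
  Row-Θ⁻ {p} {q} e with anyF-witness _ (trans (sym (Row-at (Θ T) p q)) e)
  ... | k , e' with anyF-witness _ e'
  ... | l , c with ∧-true⁻ {p ≤F k} c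
  ... | p≤k , c' with ∧-true⁻ {q ≤F l} c'
  ... | q≤l , minimal = opposite k , opposite l ,
    opposite-antitone (≤ᵇ-true⁻ p≤k) , opposite-antitone (≤ᵇ-true⁻ q≤l) , minimalOutside-Θ⁻ minimal

  Row-Θ⁺ : ∀ {p q} → AboveMaxLow (opposite p) (opposite q) → Row (Θ T) at p , q ≡ true
  Row-Θ⁺ {p} {q} (m , n , m≤p , n≤q , maxLow) = trans (Row-at (Θ T) p q)
    (anyF-intro _ (opposite m) (anyF-intro _ (opposite n)
      (∧-true⁺ (≤ᵇ-true⁺ (opposite-galois′ m≤p)) (∧-true⁺ (≤ᵇ-true⁺ (opposite-galois′ n≤q))
        (minimalOutside-Θ⁺ (subst₂ MaxLow (sym (FP.opposite-involutive m)) (sym (FP.opposite-involutive n)) maxLow))))))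

  Θ-KPro : Θ (KPro T) ≡ Row (Θ T)
  Θ-KPro = ≡-entrywise λ p q → begin
    Θ (KPro T) at p , q                                     ≡⟨ Θ-at (KPro T) p q ⟩
    high? (KPro T) (opposite p) (opposite q)                ≡⟨ high?-KPro (opposite p) (opposite q) ⟩
    sliding? (opposite p) (opposite q) ∧ seAllHigh (opposite p) (opposite q)
      ≡⟨ bool-ext (λ e → let slides , seHigh = ∧-true⁻ e in Row-Θ⁺ (sliding-seAllHigh⇒aboveMaxLow slides seHigh))
                  (λ e → let above = Row-Θ⁻ e in ∧-true⁺ (sliding?-above above) (aboveMaxLow-seAllHigh above)) ⟩
    Row (Θ T) at p , q                                      ∎
    where open ≡-Reasoning

lemma3p1 : (a b : ℕ) → 1 ≤ a → 1 ≤ b →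
    ((T : Tab a b) → IsInc (a + b) T → IsIdeal (Θ T))
    × ((T T' : Tab a b) → IsInc (a + b) T → IsInc (a + b) T' → Θ T ≡ Θ T' → T ≡ T')
    × ((I : Sub a b) → IsIdeal I → Σ (Tab a b) (λ T → IsInc (a + b) T × Θ T ≡ I))
    × ((T : Tab a b) → IsInc (a + b) T → Θ (KPro T) ≡ Row (Θ T))
lemma3p1 a b _ _ =
    Θ-isIdeal
  , Θ-injective
  , (λ I ideal → fromIdeal I , fromIdeal-isInc I ideal , Θ-fromIdeal I)
  , Sliding.Θ-KPro
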